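{- Let $G=(V,E)$ be a DAG with topological order $v_1,\ldots,v_{|V|}$, and for $i\in\{0,\ldots,|V|\}$ let $G_i=G[\{v_1,\ldots,v_i\}]$ and let $S_i$ be the support of $G_i$. Let $i\in\{1,\ldots,|V|\}$ and $v\in\{v_1,\ldots,v_i\}$. If $v\notin S_i$, then $v\notin S_j$ for all $j\in\{i,\ldots,|V|\}$.
   Context: A topological order is an ordering of the vertices such that every edge goes from an earlier to a later vertex; $G_0$ is the empty graph. In a directed graph $H$, $u$ reaches $v$ if there is a path (sequence of distinct vertices, consecutive ones joined by edges of $H$, at least one vertex) from $u$ to $v$ in $H$. An antichain of $H$ is a set of vertices no one of which reaches a different one in $H$. A set $A$ reaches $v$ if some $u\in A$ reaches $v$. For antichains $A,B$ of $H$ of the same size, $B$ dominates $A$ (in $H$) if for every $b\in B$, $A$ reaches $b$ in $H$; antichains of different sizes are not related. An $H$-frontier antichain is an antichain of $H$ not dominated in $H$ by any other antichain of $H$. The support $S_i$ of $G_i$ is the union of all $G_i$-frontier antichains. -}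

module Defs where

open import Data.Nat using (ℕ; _<_)
open import Data.Fin using (Fin; toℕ)
open import Data.Fin.Subset using (Subset; _∈_; ∣_∣)
open import Data.Product using (Σ; _×_; ∃)
open import Relation.Nullary using (¬_)
open import Relation.Binary.PropositionalEquality using (_≡_; _≢_)

-- A digraph G on vertex set Fin n, given by its edge relation.
-- The topological order v_1,...,v_n is the index order: v_{k+1} = the vertex k.
Digraph : ℕ → Set₁
Digraph n = Fin n → Fin n → Set

IsTopOrder : ∀ {n} → Digraph n → Set
IsTopOrder {n} E = ∀ (u w : Fin n) → E u w → toℕ u < toℕ w

-- Vertex set of G_i = G[{v_1,...,v_i}]: vertices of index < i.
InG : ∀ {n} → ℕ → Fin n → Set
InG i u = toℕ u < i

data Reaches {n} (E : Digraph n) (i : ℕ) : Fin n → Fin n → Set where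
  here : ∀ {u} → InG i u → Reaches E i u u
  step : ∀ {u w v} → InG i u → E u w → Reaches E i w v → Reaches E i u v

Antichain : ∀ {n} → Digraph n → ℕ → Subset n → Set
Antichain E i A =
  (∀ u → u ∈ A → InG i u) ×
  (∀ u v → u ∈ A → v ∈ A → u ≢ v → ¬ Reaches E i u v)

Dominates : ∀ {n} → Digraph n → ℕ → Subset n → Subset n → Set
Dominates {n} E i A B =
  (∣ A ∣ ≡ ∣ B ∣) × (∀ b → b ∈ B → Σ (Fin n) λ a → a ∈ A × Reaches E i a b)

Frontier : ∀ {n} → Digraph n → ℕ → Subset n → Set
Frontier {n} E i A =
  Antichain E i A ×
  (∀ (B : Subset n) → Antichain E i B → B ≢ A → ¬ Dominates E i A B)

-- v ∈ S_i, the support of G_i (union of all G_i-frontier antichains).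
InSupport : ∀ {n} → Digraph n → ℕ → Fin n → Set
InSupport {n} E i v = Σ (Subset n) λ A → Frontier E i A × v ∈ A

-- Let w be the vertex added in passing from G_i to G_{i+1}; by the topological
-- order it is a sink of G_{i+1}.  A
-- G_{i+1}-frontier antichain A avoiding w is already G_i-frontier, since
-- antichains and dominations in G_i persist in G_{i+1}.  If w ∈ A, then A - w
-- is G_i-frontier: a G_i-antichain B dominating A - w would give the
-- G_{i+1}-antichain B ∪ {w} dominating A (nothing in B reaches w, because its
-- dominator in A - w would then reach w).  Hence every vertex of G_i in S_{i+1}
-- is in S_i, and the claim follows by induction on j.
module Submission where

open import Defs
open import Data.Nat using (ℕ; suc; _≤_; _<_; _≤′_; ≤′-reflexive; ≤′-step)
open import Data.Nat.Properties
  using (≤-refl; <⇒≤; <-≤-trans; ≤-<-trans; <-irrefl; ≤-antisym; ≤∧≢⇒<; ≤-pred; m≤n⇒m≤1+n; n≤1+n; ≤⇒≤′; ≤′⇒≤)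
open import Data.Fin using (Fin; toℕ; fromℕ<)
open import Data.Fin.Properties using (toℕ-injective; toℕ-fromℕ<)
open import Data.Fin.Subset using (Subset; _∈_; _∉_; _⊆_; ∣_∣; _─_; _-_; _∪_; ⁅_⁆; inside; outside)
open import Data.Fin.Subset.Properties
  using (_∈?_; p─⊥≡p; p─q⊆p; x∈p∧x≢y⇒x∈p-y; x∉⁅y⁆⇒x≢y; x∈⁅x⁆; x∈⁅y⁆⇒x≡y; x∈p∪q⁺; x∈p∪q⁻; ⊆-antisym)
open import Data.Vec using (_∷_; here; there)
open import Data.Product using (Σ; _×_; _,_; proj₁; proj₂)
open import Data.Sum using (inj₁; inj₂)
open import Function using (_∘_; id)
open import Relation.Nullary using (¬_; yes; no; contradiction)
open import Relation.Binary.PropositionalEquality using (_≡_; _≢_; refl; sym; trans; cong; subst)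

x∈p─q⇒x∉q : ∀ {n} {x : Fin n} (p q : Subset n) → x ∈ p ─ q → x ∉ q
x∈p─q⇒x∉q (_ ∷ p) (outside ∷ q) here ()
x∈p─q⇒x∉q (_ ∷ p) (_ ∷ q) (there x∈p─q) (there x∈q) = x∈p─q⇒x∉q p q x∈p─q x∈q

x∈p-y⇒x≢y : ∀ {n} {x y : Fin n} (p : Subset n) → x ∈ p - y → x ≢ y
x∈p-y⇒x≢y {y = y} p = x∉⁅y⁆⇒x≢y ∘ x∈p─q⇒x∉q p ⁅ y ⁆

x∈p⇒∣p∣≡1+∣p-x∣ : ∀ {n} {x : Fin n} {p : Subset n} → x ∈ p → ∣ p ∣ ≡ suc ∣ p - x ∣
x∈p⇒∣p∣≡1+∣p-x∣ {p = inside ∷ p} here = cong (suc ∘ ∣_∣) (sym (p─⊥≡p p))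
x∈p⇒∣p∣≡1+∣p-x∣ {p = inside ∷ p} (there x∈p) = cong suc (x∈p⇒∣p∣≡1+∣p-x∣ x∈p)
x∈p⇒∣p∣≡1+∣p-x∣ {p = outside ∷ p} (there x∈p) = x∈p⇒∣p∣≡1+∣p-x∣ x∈p

x∉p⇒p∪⁅x⁆-x≡p : ∀ {n} {x : Fin n} {p : Subset n} → x ∉ p → (p ∪ ⁅ x ⁆) - x ≡ p
x∉p⇒p∪⁅x⁆-x≡p {x = x} {p} x∉p = ⊆-antisym ⊆p p⊆
  where
  ⊆p : (p ∪ ⁅ x ⁆) - x ⊆ p
  ⊆p {y} y∈ with x∈p∪q⁻ p ⁅ x ⁆ (p─q⊆p _ _ y∈)
  ... | inj₁ y∈p = y∈p
  ... | inj₂ y∈⁅x⁆ = contradiction (x∈⁅y⁆⇒x≡y x y∈⁅x⁆) (x∈p-y⇒x≢y (p ∪ ⁅ x ⁆) y∈)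
  p⊆ : p ⊆ (p ∪ ⁅ x ⁆) - x
  p⊆ {y} y∈p = x∈p∧x≢y⇒x∈p-y (x∈p∪q⁺ (inj₁ y∈p)) λ { refl → x∉p y∈p }

x∉p⇒∣p∪⁅x⁆∣≡1+∣p∣ : ∀ {n} {x : Fin n} {p : Subset n} → x ∉ p → ∣ p ∪ ⁅ x ⁆ ∣ ≡ suc ∣ p ∣
x∉p⇒∣p∪⁅x⁆∣≡1+∣p∣ {x = x} {p} x∉p = trans
  (x∈p⇒∣p∣≡1+∣p-x∣ (x∈p∪q⁺ {p = p} (inj₂ (x∈⁅x⁆ x))))
  (cong (suc ∘ ∣_∣) (x∉p⇒p∪⁅x⁆-x≡p x∉p))

InG-suc-≢ : ∀ {n i} {u w : Fin n} → toℕ w ≡ i → InG (suc i) u → u ≢ w → InG i u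
InG-suc-≢ w≡i u<1+i u≢w = ≤∧≢⇒< (≤-pred u<1+i) (λ u≡i → u≢w (toℕ-injective (trans u≡i (sym w≡i))))

module _ {n : ℕ} {E : Digraph n} where

  reaches-InG : ∀ {i u x} → Reaches E i u x → InG i x
  reaches-InG (here x∈Gi) = x∈Gi
  reaches-InG (step _ _ r) = reaches-InG r

  reaches-trans : ∀ {i a u x} → Reaches E i a u → Reaches E i u x → Reaches E i a x
  reaches-trans (here _) r = r
  reaches-trans (step a∈Gi e r) r′ = step a∈Gi e (reaches-trans r r′)

  reaches-mono : ∀ {i j u x} → i ≤ j → Reaches E i u x → Reaches E j u x
  reaches-mono i≤j (here x∈Gi) = here (<-≤-trans x∈Gi i≤j)
  reaches-mono i≤j (step u∈Gi e r) = step (<-≤-trans u∈Gi i≤j) e (reaches-mono i≤j r)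

  dominates-mono : ∀ {i j A B} → i ≤ j → Dominates E i A B → Dominates E j A B
  dominates-mono i≤j (∣A∣≡∣B∣ , dom) = ∣A∣≡∣B∣ , λ b b∈B →
    let (a , a∈A , r) = dom b b∈B in a , a∈A , reaches-mono i≤j r

  antichain-⊆ : ∀ {i A B} → B ⊆ A → Antichain E i A → Antichain E i B
  antichain-⊆ B⊆A (A⊆Gi , indep) =
    (λ u → A⊆Gi u ∘ B⊆A) , λ u x u∈B x∈B → indep u x (B⊆A u∈B) (B⊆A x∈B)

  antichain-restrict : ∀ {i j A} → i ≤ j → (∀ u → u ∈ A → InG i u) →
    Antichain E j A → Antichain E i A
  antichain-restrict i≤j A⊆Gi (_ , indep) =
    A⊆Gi , λ u x u∈A x∈A u≢x → indep u x u∈A x∈A u≢x ∘ reaches-mono i≤j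

  module _ (top : IsTopOrder E) where

    reaches-≤ : ∀ {i u x} → Reaches E i u x → toℕ u ≤ toℕ x
    reaches-≤ (here _) = ≤-refl
    reaches-≤ (step _ e r) = <⇒≤ (<-≤-trans (top _ _ e) (reaches-≤ r))

    -- Every vertex on a path precedes its endpoint in the topological order.
    reaches-restrict : ∀ {i j u x} → InG i x → Reaches E j u x → Reaches E i u x
    reaches-restrict x∈Gi (here _) = here x∈Gi
    reaches-restrict x∈Gi r@(step _ e r′) =
      step (≤-<-trans (reaches-≤ r) x∈Gi) e (reaches-restrict x∈Gi r′)

    reaches-from-last : ∀ {i w x} → toℕ w ≡ i → Reaches E (suc i) w x → x ≡ w
    reaches-from-last {x = x} w≡i r = toℕ-injective
      (≤-antisym (subst (toℕ x ≤_) (sym w≡i) (≤-pred (reaches-InG r))) (reaches-≤ r))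

    antichain-mono : ∀ {i j A} → i ≤ j → Antichain E i A → Antichain E j A
    antichain-mono i≤j (A⊆Gi , indep) =
      (λ u u∈A → <-≤-trans (A⊆Gi u u∈A) i≤j) ,
      λ u x u∈A x∈A u≢x r → indep u x u∈A x∈A u≢x (reaches-restrict (A⊆Gi x x∈A) r)

    frontier-restrict : ∀ {i j A} → i ≤ j → (∀ u → u ∈ A → InG i u) →
      Frontier E j A → Frontier E i A
    frontier-restrict i≤j A⊆Gi (antiA , maxA) =
      antichain-restrict i≤j A⊆Gi antiA ,
      λ B antiB B≢A → maxA B (antichain-mono i≤j antiB) B≢A ∘ dominates-mono i≤j

    antichain-add-last : ∀ {i w B} → toℕ w ≡ i → Antichain E i B →
      (∀ b → b ∈ B → ¬ Reaches E (suc i) b w) → Antichain E (suc i) (B ∪ ⁅ w ⁆)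
    antichain-add-last {i} {w} {B} w≡i (B⊆Gi , indepB) ¬b↝w = B+w⊆Gi+1 , indep
      where
      B+w⊆Gi+1 : ∀ u → u ∈ B ∪ ⁅ w ⁆ → InG (suc i) u
      B+w⊆Gi+1 u u∈ with x∈p∪q⁻ B ⁅ w ⁆ u∈
      ... | inj₁ u∈B = m≤n⇒m≤1+n (B⊆Gi u u∈B)
      ... | inj₂ u∈⁅w⁆ rewrite x∈⁅y⁆⇒x≡y w u∈⁅w⁆ | w≡i = ≤-refl
      indep : ∀ u x → u ∈ B ∪ ⁅ w ⁆ → x ∈ B ∪ ⁅ w ⁆ → u ≢ x → ¬ Reaches E (suc i) u x
      indep u x u∈ x∈ u≢x r with x∈p∪q⁻ B ⁅ w ⁆ u∈ | x∈p∪q⁻ B ⁅ w ⁆ x∈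
      ... | inj₂ u∈⁅w⁆ | _ rewrite x∈⁅y⁆⇒x≡y w u∈⁅w⁆ = u≢x (sym (reaches-from-last w≡i r))
      ... | inj₁ u∈B | inj₂ x∈⁅w⁆ rewrite x∈⁅y⁆⇒x≡y w x∈⁅w⁆ = ¬b↝w u u∈B r
      ... | inj₁ u∈B | inj₁ x∈B = indepB u x u∈B x∈B u≢x (reaches-restrict (B⊆Gi x x∈B) r)

    frontier-remove-last : ∀ {i w A} → toℕ w ≡ i → w ∈ A →
      Frontier E (suc i) A → Frontier E i (A - w)
    frontier-remove-last {i} {w} {A} w≡i w∈A (antiA , maxA) =
      antichain-restrict (n≤1+n i) A-w⊆Gi (antichain-⊆ (p─q⊆p A ⁅ w ⁆) antiA) , maxA-w
      where
      A-w⊆Gi : ∀ u → u ∈ A - w → InG i u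
      A-w⊆Gi u u∈ = InG-suc-≢ w≡i (proj₁ antiA u (p─q⊆p _ _ u∈)) (x∈p-y⇒x≢y A u∈)
      maxA-w : ∀ B → Antichain E i B → B ≢ A - w → ¬ Dominates E i (A - w) B
      maxA-w B antiB B≢A-w (∣A-w∣≡∣B∣ , dom) = maxA (B ∪ ⁅ w ⁆)
        (antichain-add-last w≡i antiB ¬b↝w) B+w≢A (∣A∣≡∣B+w∣ , dom+w)
        where
        w∉B : w ∉ B
        w∉B w∈B = <-irrefl w≡i (proj₁ antiB w w∈B)
        -- b is reached from some a ∈ A - w, which would then reach w ∈ A.
        ¬b↝w : ∀ b → b ∈ B → ¬ Reaches E (suc i) b w
        ¬b↝w b b∈B b↝w =
          let (a , a∈A-w , a↝b) = dom b b∈B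
          in proj₂ antiA a w (p─q⊆p _ _ a∈A-w) w∈A (x∈p-y⇒x≢y A a∈A-w)
               (reaches-trans (reaches-mono (n≤1+n i) a↝b) b↝w)
        B+w≢A : B ∪ ⁅ w ⁆ ≢ A
        B+w≢A B+w≡A = B≢A-w (trans (sym (x∉p⇒p∪⁅x⁆-x≡p w∉B)) (cong (_- w) B+w≡A))
        ∣A∣≡∣B+w∣ : ∣ A ∣ ≡ ∣ B ∪ ⁅ w ⁆ ∣
        ∣A∣≡∣B+w∣ = trans (x∈p⇒∣p∣≡1+∣p-x∣ w∈A)
          (trans (cong suc ∣A-w∣≡∣B∣) (sym (x∉p⇒∣p∪⁅x⁆∣≡1+∣p∣ w∉B)))
        dom+w : ∀ b → b ∈ B ∪ ⁅ w ⁆ → Σ (Fin n) λ a → a ∈ A × Reaches E (suc i) a b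
        dom+w b b∈ with x∈p∪q⁻ B ⁅ w ⁆ b∈
        ... | inj₁ b∈B = let (a , a∈A-w , a↝b) = dom b b∈B
                         in a , p─q⊆p _ _ a∈A-w , reaches-mono (n≤1+n i) a↝b
        ... | inj₂ b∈⁅w⁆ rewrite x∈⁅y⁆⇒x≡y w b∈⁅w⁆ = w , w∈A , here (subst (_< suc i) (sym w≡i) ≤-refl)

    support-step : ∀ {i v} → i < n → toℕ v < i → InSupport E (suc i) v → InSupport E i v
    support-step {i} {v} i<n v<i (A , frontierA , v∈A) with fromℕ< i<n ∈? A
    ... | no w∉A = A , frontier-restrict (n≤1+n i) A⊆Gi frontierA , v∈A
      where
      A⊆Gi : ∀ u → u ∈ A → InG i u
      A⊆Gi u u∈A = InG-suc-≢ (toℕ-fromℕ< i<n) (proj₁ (proj₁ frontierA) u u∈A)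
        λ { refl → w∉A u∈A }
    ... | yes w∈A = A - w , frontier-remove-last w≡i w∈A frontierA ,
        x∈p∧x≢y⇒x∈p-y v∈A λ { refl → <-irrefl w≡i v<i }
      where
      w : Fin n
      w = fromℕ< i<n
      w≡i : toℕ w ≡ i
      w≡i = toℕ-fromℕ< i<n

    support-antitone : ∀ {i j v} → toℕ v < i → i ≤′ j → j ≤ n → InSupport E j v → InSupport E i v
    support-antitone v<i (≤′-reflexive refl) _ = id
    support-antitone v<i (≤′-step i≤′j) j<n =
      support-antitone v<i i≤′j (<⇒≤ j<n) ∘ support-step j<n (<-≤-trans v<i (≤′⇒≤ i≤′j))

lemma7 : (n : ℕ) (E : Digraph n) → IsTopOrder E →
    (i : ℕ) → 1 ≤ i → i ≤ n →
    (v : Fin n) → toℕ v < i →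
    ¬ InSupport E i v →
    (j : ℕ) → i ≤ j → j ≤ n → ¬ InSupport E j v
lemma7 n E top i _ _ v v<i v∉Si j i≤j j≤n =
  v∉Si ∘ support-antitone top v<i (≤⇒≤′ i≤j) j≤n
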